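{- Let $t$ be the translation from $\mathcal{L}_\mathsf{PAL}$ to $\mathcal{L}_\mathsf{EL}$ defined below, extended by $t(x\sim_ay)=x\sim_ay$, $t(x:\varphi)=x:t(\varphi)$, and elementwise to multisets. For every labelled $\mathcal{L}_\mathsf{PAL}$-sequent $\Gamma\Rightarrow\Delta$: (1) if $G_\mathsf{EL}\vdash t(\Gamma)\Rightarrow t(\Delta)$, then $G_\mathsf{PAL}\vdash\Gamma\Rightarrow\Delta$; (2) for every $h\ge 1$, if $G_\mathsf{PAL}\vdash_h\Gamma\Rightarrow\Delta$, then $G_\mathsf{EL}\vdash_h t(\Gamma)\Rightarrow t(\Delta)$.
   Context: Fix a denumerable set $\mathsf{Prop}$ of propositional variables and a finite set $\mathsf{Ag}$ of agents. $\mathcal{L}_\mathsf{PAL}$-formulas are given by $\varphi ::= p \mid \neg\varphi \mid \varphi\land\varphi \mid \varphi\to\varphi \mid K_a\varphi \mid [\varphi]\varphi$ with $p\in\mathsf{Prop}$, $a\in\mathsf{Ag}$; $\mathcal{L}_\mathsf{EL}$ is the fragment without $[\cdot]$. Fix a countable set of labels $x,y,z,\dots$. A relational atom is $x\sim_a y$; a labelled formula is $x:\varphi$. A labelled sequent $\Gamma\Rightarrow\Delta$ has $\Gamma,\Delta$ finite multisets of relational atoms and labelled formulas. The translation $t:\mathcal{L}_\mathsf{PAL}\to\mathcal{L}_\mathsf{EL}$ is defined by: $t(p)=p$, $t(\neg\varphi)=\neg t(\varphi)$, $t(\varphi\land\psi)=t(\varphi)\land t(\psi)$, $t(\varphi\to\psi)=t(\varphi)\to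 t(\psi)$, $t(K_a\varphi)=K_at(\varphi)$, $t([\varphi]p)=t(\varphi\to p)$, $t([\varphi]\neg\psi)=t(\varphi\to\neg[\varphi]\psi)$, $t([\varphi](\psi\land\chi))=t([\varphi]\psi\land[\varphi]\chi)$, $t([\varphi](\psi\to\chi))=t([\varphi]\psi\to[\varphi]\chi)$, $t([\varphi]K_a\psi)=t(\varphi\to K_a[\varphi]\psi)$, $t([\varphi][\psi]\chi)=t([\varphi\land[\varphi]\psi]\chi)$. The calculus $G_\mathsf{EL}$ has initial sequents $x:p,\Gamma\Rightarrow\Delta,x:p$ and $x\sim_ay,\Gamma\Rightarrow\Delta,x\sim_ay$ and the rules: $(\neg\Rightarrow)\ \frac{\Gamma\Rightarrow\Delta,x:\varphi}{x:\neg\varphi,\Gamma\Rightarrow\Delta}$; $(\Rightarrow\neg)\ \frac{x:\varphi,\Gamma\Rightarrow\Delta}{\Gamma\Rightarrow\Delta,x:\neg\varphi}$; $(\land\Rightarrow)\ \frac{x:\varphi_1,x:\varphi_2,\Gamma\Rightarrow\Delta}{x:\varphi_1\land\varphi_2,\Gamma\Rightarrow\Delta}$; $(\Rightarrow\land)\ \frac{\Gamma\Rightarrow\Delta,x:\varphi_1\quad \Gamma\Rightarrow\Delta,x:\varphi_2}{\Gamma\Rightarrow\Delta,x:\varphi_1\land\varphi_2}$; $(\to\Rightarrow)\ \frac{\Gamma\Rightarrow\Delta,x:\varphi\quad x:\psi,\Gamma\Rightarrow\Delta}{x:\varphi\to\psi,\Gamma\Rightarrow\Delta}$; $(\Rightarrow\to)\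 \frac{x:\varphi,\Gamma\Rightarrow\Delta,x:\psi}{\Gamma\Rightarrow\Delta,x:\varphi\to\psi}$; $(K_a\Rightarrow)\ \frac{y:\varphi,x:K_a\varphi,x\sim_ay,\Gamma\Rightarrow\Delta}{x:K_a\varphi,x\sim_ay,\Gamma\Rightarrow\Delta}$; $(\Rightarrow K_a)\ \frac{x\sim_ay,\Gamma\Rightarrow\Delta,y:\varphi}{\Gamma\Rightarrow\Delta,x:K_a\varphi}$ with $y$ not occurring in the conclusion; $(\mathrm{Ref}_a)\ \frac{x\sim_ax,\Gamma\Rightarrow\Delta}{\Gamma\Rightarrow\Delta}$; $(\mathrm{Trans}_a)\ \frac{x\sim_az,x\sim_ay,y\sim_az,\Gamma\Rightarrow\Delta}{x\sim_ay,y\sim_az,\Gamma\Rightarrow\Delta}$; $(\mathrm{Sym}_a)\ \frac{y\sim_ax,x\sim_ay,\Gamma\Rightarrow\Delta}{x\sim_ay,\Gamma\Rightarrow\Delta}$. $G_\mathsf{PAL}$ is $G_\mathsf{EL}$ (with formulas ranging over $\mathcal{L}_\mathsf{PAL}$) plus the reduction rules: $(R1\Rightarrow)\ \frac{\Gamma\Rightarrow\Delta,x:\varphi\quad x:p,\Gamma\Rightarrow\Delta}{x:[\varphi]p,\Gamma\Rightarrow\Delta}$; $(\Rightarrow R1)\ \frac{x:\varphi,\Gamma\Rightarrow\Delta,x:p}{\Gamma\Rightarrow\Delta,x:[\varphi]p}$; $(R2\Rightarrow)\ \frac{\Gamma\Rightarrow\Delta,x:\varphi\quad x:\neg[\varphi]\psi,\Gamma\Rightarrow\Delta}{x:[\varphi]\neg\psi,\Gamma\Rightarrow\Delta}$;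 $(\Rightarrow R2)\ \frac{x:\varphi,\Gamma\Rightarrow\Delta,x:\neg[\varphi]\psi}{\Gamma\Rightarrow\Delta,x:[\varphi]\neg\psi}$; $(R3\Rightarrow)\ \frac{x:[\varphi]\psi_1,x:[\varphi]\psi_2,\Gamma\Rightarrow\Delta}{x:[\varphi](\psi_1\land\psi_2),\Gamma\Rightarrow\Delta}$; $(\Rightarrow R3)\ \frac{\Gamma\Rightarrow\Delta,x:[\varphi]\psi_1\quad\Gamma\Rightarrow\Delta,x:[\varphi]\psi_2}{\Gamma\Rightarrow\Delta,x:[\varphi](\psi_1\land\psi_2)}$; $(R4\Rightarrow)\ \frac{\Gamma\Rightarrow\Delta,x:[\varphi]\psi_1\quad x:[\varphi]\psi_2,\Gamma\Rightarrow\Delta}{x:[\varphi](\psi_1\to\psi_2),\Gamma\Rightarrow\Delta}$; $(\Rightarrow R4)\ \frac{x:[\varphi]\psi_1,\Gamma\Rightarrow\Delta,x:[\varphi]\psi_2}{\Gamma\Rightarrow\Delta,x:[\varphi](\psi_1\to\psi_2)}$; $(R5\Rightarrow)\ \frac{\Gamma\Rightarrow\Delta,x:\varphi\quad x:K_a[\varphi]\psi,\Gamma\Rightarrow\Delta}{x:[\varphi]K_a\psi,\Gamma\Rightarrow\Delta}$; $(\Rightarrow R5)\ \frac{x:\varphi,\Gamma\Rightarrow\Delta,x:K_a[\varphi]\psi}{\Gamma\Rightarrow\Delta,x:[\varphi]K_a\psi}$; $(R6\Rightarrow)\ \frac{x:[\varphi\land[\varphi]\psi]\chi,\Gamma\Rightarrow\Delta}{x:[\varphi][\psi]\chi,\Gamma\Rightarrow\Delta}$;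 $(\Rightarrow R6)\ \frac{\Gamma\Rightarrow\Delta,x:[\varphi\land[\varphi]\psi]\chi}{\Gamma\Rightarrow\Delta,x:[\varphi][\psi]\chi}$. Derivations are finite trees built from these rules with initial sequents at the leaves. The height of a derivation is the length of its longest branch (an initial sequent has height 1). $G\vdash S$ means $S$ is derivable in $G$; $G\vdash_h S$ means $S$ has a derivation in $G$ of height at most $h$. -}

module Defs where

open import Data.Nat using (ℕ; zero; suc)
open import Data.Fin using (Fin)
open import Data.List using (List; []; _∷_; _++_; map; concatMap)
open import Data.List.Membership.Propositional using (_∉_)
open import Data.List.Relation.Unary.All using (All)
open import Data.List.Relation.Binary.Permutation.Propositional using (_↭_)
open import Data.Product using (_×_; _,_; ∃)
open import Relation.Binary.PropositionalEquality using (_≡_; refl)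

Label : Set
Label = ℕ

-- L_PAL formulas over the agent set Fin n.  L_EL is the fragment
-- without [_]_ (see IsEL below).
infixr 6 _∧ᶠ_
infixr 5 _→ᶠ_
infix 7 ¬ᶠ_
data Fm (n : ℕ) : Set where
  var  : ℕ → Fm n
  ¬ᶠ_  : Fm n → Fm n
  _∧ᶠ_ : Fm n → Fm n → Fm n
  _→ᶠ_ : Fm n → Fm n → Fm n
  K    : Fin n → Fm n → Fm n
  [_]_ : Fm n → Fm n → Fm n

data IsEL {n : ℕ} : Fm n → Set where
  var : ∀ p → IsEL (var p)
  neg : ∀ {φ} → IsEL φ → IsEL (¬ᶠ φ)
  and : ∀ {φ ψ} → IsEL φ → IsEL ψ → IsEL (φ ∧ᶠ ψ)
  imp : ∀ {φ ψ} → IsEL φ → IsEL ψ → IsEL (φ →ᶠ ψ)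
  box : ∀ {a φ} → IsEL φ → IsEL (K a φ)

-- The defining equations of t are not structurally recursive (clause
-- t([φ][ψ]χ) = t([φ∧[φ]ψ]χ)); we implement t structurally via an
-- auxiliary function  ann a ψ  which computes t([φ]ψ) given a = t(φ).
-- The equations of the paper hold definitionally (see t-eq-* below).

ann : ∀ {n} → Fm n → Fm n → Fm n
ann a (var p)   = a →ᶠ var p
ann a (¬ᶠ ψ)    = a →ᶠ ¬ᶠ ann a ψ
ann a (ψ ∧ᶠ χ)  = ann a ψ ∧ᶠ ann a χ
ann a (ψ →ᶠ χ)  = ann a ψ →ᶠ ann a χ
ann a (K i ψ)   = a →ᶠ K i (ann a ψ)
ann a ([ ψ ] χ) = ann (a ∧ᶠ ann a ψ) χ

t : ∀ {n} → Fm n → Fm n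
t (var p)   = var p
t (¬ᶠ φ)    = ¬ᶠ t φ
t (φ ∧ᶠ ψ)  = t φ ∧ᶠ t ψ
t (φ →ᶠ ψ)  = t φ →ᶠ t ψ
t (K i φ)   = K i (t φ)
t ([ φ ] ψ) = ann (t φ) ψ

module _ {n : ℕ} (φ ψ χ : Fm n) (p : ℕ) (i : Fin n) where
  t-eq-1 : t ([ φ ] var p) ≡ t (φ →ᶠ var p)
  t-eq-1 = refl
  t-eq-2 : t ([ φ ] (¬ᶠ ψ)) ≡ t (φ →ᶠ ¬ᶠ ([ φ ] ψ))
  t-eq-2 = refl
  t-eq-3 : t ([ φ ] (ψ ∧ᶠ χ)) ≡ t (([ φ ] ψ) ∧ᶠ ([ φ ] χ))
  t-eq-3 = refl
  t-eq-4 : t ([ φ ] (ψ →ᶠ χ)) ≡ t (([ φ ] ψ) →ᶠ ([ φ ] χ))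
  t-eq-4 = refl
  t-eq-5 : t ([ φ ] K i ψ) ≡ t (φ →ᶠ K i ([ φ ] ψ))
  t-eq-5 = refl
  t-eq-6 : t ([ φ ] ([ ψ ] χ)) ≡ t ([ φ ∧ᶠ ([ φ ] ψ) ] χ)
  t-eq-6 = refl

-- Labelled sequents.  Multisets are lists taken up to permutation
-- (every rule may be applied to any permutation of its conclusion,
-- see `der` below).

data Item (n : ℕ) : Set where
  rel : Fin n → Label → Label → Item n
  lab : Label → Fm n → Item n

Seq : ℕ → Set
Seq n = List (Item n) × List (Item n)

tI : ∀ {n} → Item n → Item n
tI (rel a x y) = rel a x y
tI (lab x φ)   = lab x (t φ)

tL : ∀ {n} → List (Item n) → List (Item n)
tL = map tI

tS : ∀ {n} → Seq n → Seq n
tS (Γ , Δ) = tL Γ , tL Δ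

labelsI : ∀ {n} → Item n → List Label
labelsI (rel a x y) = x ∷ y ∷ []
labelsI (lab x φ)   = x ∷ []

labelsS : ∀ {n} → Seq n → List Label
labelsS (Γ , Δ) = concatMap labelsI Γ ++ concatMap labelsI Δ

data Calc : Set where
  EL PAL : Calc

-- One-step rule instances:  Rule c S ps  says S follows from premises ps
-- by a rule of calculus c (principal items displayed at the front).
data Rule {n : ℕ} : Calc → Seq n → List (Seq n) → Set where
  init-p : ∀ {c x p Γ Δ} →
    Rule c (lab x (var p) ∷ Γ , lab x (var p) ∷ Δ) []
  init-r : ∀ {c a x y Γ Δ} →
    Rule c (rel a x y ∷ Γ , rel a x y ∷ Δ) []
  ¬L : ∀ {c x φ Γ Δ} →
    Rule c (lab x (¬ᶠ φ) ∷ Γ , Δ) ((Γ , lab x φ ∷ Δ) ∷ [])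
  ¬R : ∀ {c x φ Γ Δ} →
    Rule c (Γ , lab x (¬ᶠ φ) ∷ Δ) ((lab x φ ∷ Γ , Δ) ∷ [])
  ∧L : ∀ {c x φ₁ φ₂ Γ Δ} →
    Rule c (lab x (φ₁ ∧ᶠ φ₂) ∷ Γ , Δ) ((lab x φ₁ ∷ lab x φ₂ ∷ Γ , Δ) ∷ [])
  ∧R : ∀ {c x φ₁ φ₂ Γ Δ} →
    Rule c (Γ , lab x (φ₁ ∧ᶠ φ₂) ∷ Δ)
           ((Γ , lab x φ₁ ∷ Δ) ∷ (Γ , lab x φ₂ ∷ Δ) ∷ [])
  →L : ∀ {c x φ ψ Γ Δ} →
    Rule c (lab x (φ →ᶠ ψ) ∷ Γ , Δ)
           ((Γ , lab x φ ∷ Δ) ∷ (lab x ψ ∷ Γ , Δ) ∷ [])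
  →R : ∀ {c x φ ψ Γ Δ} →
    Rule c (Γ , lab x (φ →ᶠ ψ) ∷ Δ) ((lab x φ ∷ Γ , lab x ψ ∷ Δ) ∷ [])
  KL : ∀ {c a x y φ Γ Δ} →
    Rule c (lab x (K a φ) ∷ rel a x y ∷ Γ , Δ)
           ((lab y φ ∷ lab x (K a φ) ∷ rel a x y ∷ Γ , Δ) ∷ [])
  KR : ∀ {c a x y φ Γ Δ} →
    y ∉ labelsS (Γ , lab x (K a φ) ∷ Δ) →
    Rule c (Γ , lab x (K a φ) ∷ Δ) ((rel a x y ∷ Γ , lab y φ ∷ Δ) ∷ [])
  Ref : ∀ {c a x Γ Δ} →
    Rule c (Γ , Δ) ((rel a x x ∷ Γ , Δ) ∷ [])
  Trans : ∀ {c a x y z Γ Δ} →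
    Rule c (rel a x y ∷ rel a y z ∷ Γ , Δ)
           ((rel a x z ∷ rel a x y ∷ rel a y z ∷ Γ , Δ) ∷ [])
  Sym : ∀ {c a x y Γ Δ} →
    Rule c (rel a x y ∷ Γ , Δ) ((rel a y x ∷ rel a x y ∷ Γ , Δ) ∷ [])
  R1L : ∀ {x φ p Γ Δ} →
    Rule PAL (lab x ([ φ ] var p) ∷ Γ , Δ)
             ((Γ , lab x φ ∷ Δ) ∷ (lab x (var p) ∷ Γ , Δ) ∷ [])
  R1R : ∀ {x φ p Γ Δ} →
    Rule PAL (Γ , lab x ([ φ ] var p) ∷ Δ) ((lab x φ ∷ Γ , lab x (var p) ∷ Δ) ∷ [])
  R2L : ∀ {x φ ψ Γ Δ} →
    Rule PAL (lab x ([ φ ] (¬ᶠ ψ)) ∷ Γ , Δ)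
             ((Γ , lab x φ ∷ Δ) ∷ (lab x (¬ᶠ ([ φ ] ψ)) ∷ Γ , Δ) ∷ [])
  R2R : ∀ {x φ ψ Γ Δ} →
    Rule PAL (Γ , lab x ([ φ ] (¬ᶠ ψ)) ∷ Δ)
             ((lab x φ ∷ Γ , lab x (¬ᶠ ([ φ ] ψ)) ∷ Δ) ∷ [])
  R3L : ∀ {x φ ψ₁ ψ₂ Γ Δ} →
    Rule PAL (lab x ([ φ ] (ψ₁ ∧ᶠ ψ₂)) ∷ Γ , Δ)
             ((lab x ([ φ ] ψ₁) ∷ lab x ([ φ ] ψ₂) ∷ Γ , Δ) ∷ [])
  R3R : ∀ {x φ ψ₁ ψ₂ Γ Δ} →
    Rule PAL (Γ , lab x ([ φ ] (ψ₁ ∧ᶠ ψ₂)) ∷ Δ)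
             ((Γ , lab x ([ φ ] ψ₁) ∷ Δ) ∷ (Γ , lab x ([ φ ] ψ₂) ∷ Δ) ∷ [])
  R4L : ∀ {x φ ψ₁ ψ₂ Γ Δ} →
    Rule PAL (lab x ([ φ ] (ψ₁ →ᶠ ψ₂)) ∷ Γ , Δ)
             ((Γ , lab x ([ φ ] ψ₁) ∷ Δ) ∷ (lab x ([ φ ] ψ₂) ∷ Γ , Δ) ∷ [])
  R4R : ∀ {x φ ψ₁ ψ₂ Γ Δ} →
    Rule PAL (Γ , lab x ([ φ ] (ψ₁ →ᶠ ψ₂)) ∷ Δ)
             ((lab x ([ φ ] ψ₁) ∷ Γ , lab x ([ φ ] ψ₂) ∷ Δ) ∷ [])
  R5L : ∀ {x a φ ψ Γ Δ} →
    Rule PAL (lab x ([ φ ] K a ψ) ∷ Γ , Δ)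
             ((Γ , lab x φ ∷ Δ) ∷ (lab x (K a ([ φ ] ψ)) ∷ Γ , Δ) ∷ [])
  R5R : ∀ {x a φ ψ Γ Δ} →
    Rule PAL (Γ , lab x ([ φ ] K a ψ) ∷ Δ)
             ((lab x φ ∷ Γ , lab x (K a ([ φ ] ψ)) ∷ Δ) ∷ [])
  R6L : ∀ {x φ ψ χ Γ Δ} →
    Rule PAL (lab x ([ φ ] ([ ψ ] χ)) ∷ Γ , Δ)
             ((lab x ([ φ ∧ᶠ ([ φ ] ψ) ] χ) ∷ Γ , Δ) ∷ [])
  R6R : ∀ {x φ ψ χ Γ Δ} →
    Rule PAL (Γ , lab x ([ φ ] ([ ψ ] χ)) ∷ Δ)
             ((Γ , lab x ([ φ ∧ᶠ ([ φ ] ψ) ] χ) ∷ Δ) ∷ [])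

-- c ⊢[ h ] S : S has a derivation in calculus c of height at most h
-- (an initial sequent has height 1; a rule application has height
-- 1 + max of premise heights).
data _⊢[_]_ {n : ℕ} (c : Calc) : ℕ → Seq n → Set where
  der : ∀ {h Γ Δ Γ' Δ' ps} →
        Rule c (Γ , Δ) ps →
        Γ' ↭ Γ → Δ' ↭ Δ →
        All (c ⊢[ h ]_) ps →
        c ⊢[ suc h ] (Γ' , Δ')

_⊢_ : ∀ {n} → Calc → Seq n → Set
c ⊢ S = ∃ λ h → c ⊢[ h ] S

-- Every rule of G_PAL other than R6 becomes, under t, an instance of the G_EL rule for the
-- connective that t produces at the principal formula, and R6 disappears because its premise
-- and conclusion have the same translation; so G_PAL derivations translate rule by rule
-- without growing. Conversely, a formula whose translation has a variable, a negation or a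
-- K at the top has that symbol at the top itself (translated announcements are implications
-- or conjunctions), and a formula whose translation is an implication or a conjunction is
-- either that connective or an announcement whose reduction rules, after finitely many R6
-- steps, have exactly the premises of the corresponding G_EL rule. Hence every G_EL rule
-- applied to a translated sequent can be reflected into G_PAL.
module Submission where

open import Defs
open import Data.Nat using (ℕ; _≤_; suc; s≤s; _⊔_)
open import Data.Nat.Properties using (n≤1+n; m≤m⊔n; m≤n⊔m)
open import Data.Fin using (Fin)
open import Data.List using (List; []; _∷_; _++_; map; concatMap)
open import Data.List.Properties using (concatMap-map; concatMap-cong)
open import Data.List.Membership.Propositional using (_∈_)
open import Data.List.Relation.Unary.All using (All; []; _∷_)
open import Data.List.Relation.Unary.All.Properties using () renaming (map⁺ to All-map⁺)
open import Data.List.Relation.Binary.Permutation.Propositional using (_↭_; ↭-trans; ↭-refl)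
open import Data.List.Relation.Binary.Permutation.Propositional.Properties using (map⁺; ↭-map-inv)
open import Data.Product using (_×_; _,_; ∃; ∃₂; -,_)
open import Data.Sum using (_⊎_; inj₁; inj₂)
open import Function using (_∘_)
open import Relation.Binary.PropositionalEquality using (_≡_; refl; sym; trans; subst; cong₂; _≗_)

variable
  n : ℕ
  c : Calc
  h h′ : ℕ
  x : Label
  a : Fin n
  F A B : Fm n
  Γ Δ Γ′ Δ′ Γ₀ : List (Item n)
  S : Seq n

⊢[]-mono : h ≤ h′ → c ⊢[ h ] S → c ⊢[ h′ ] S
⊢[]-mono {h′ = suc h′} (s≤s h≤h′) (der r p q ds) = der r p q (all-mono ds)
  where
  all-mono : ∀ {ps} → All (c ⊢[ _ ]_) ps → All (c ⊢[ h′ ]_) ps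
  all-mono []       = []
  all-mono (d ∷ ds) = ⊢[]-mono h≤h′ d ∷ all-mono ds

⊢[]-resp-↭ : c ⊢[ h ] (Γ , Δ) → Γ′ ↭ Γ → Δ′ ↭ Δ → c ⊢[ h ] (Γ′ , Δ′)
⊢[]-resp-↭ (der r p q ds) p′ q′ = der r (↭-trans p′ p) (↭-trans q′ q) ds

⊢-resp-↭ : c ⊢ (Γ , Δ) → Γ′ ↭ Γ → Δ′ ↭ Δ → c ⊢ (Γ′ , Δ′)
⊢-resp-↭ (h , d) p q = h , ⊢[]-resp-↭ d p q

⊢-rule₁ : ∀ {S′ : Seq n} → Rule c (Γ , Δ) (S′ ∷ []) → c ⊢ S′ → c ⊢ (Γ , Δ)
⊢-rule₁ r (h , d) = suc h , der r ↭-refl ↭-refl (d ∷ [])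

⊢-rule₂ : ∀ {S₁ S₂ : Seq n} → Rule c (Γ , Δ) (S₁ ∷ S₂ ∷ []) → c ⊢ S₁ → c ⊢ S₂ → c ⊢ (Γ , Δ)
⊢-rule₂ r (h , d) (k , e) =
  suc (h ⊔ k) , der r ↭-refl ↭-refl (⊢[]-mono (m≤m⊔n h k) d ∷ ⊢[]-mono (m≤n⊔m h k) e ∷ [])

labels-tL : (X : List (Item n)) → concatMap labelsI (tL X) ≡ concatMap labelsI X
labels-tL X = trans (concatMap-map labelsI tI X) (concatMap-cong labelsI-tI X)
  where
  labelsI-tI : labelsI ∘ tI ≗ labelsI {n}
  labelsI-tI (rel _ _ _) = refl
  labelsI-tI (lab _ _)   = refl

labelsS-tS : (S : Seq n) → labelsS (tS S) ≡ labelsS S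
labelsS-tS (Γ , Δ) = cong₂ _++_ (labels-tL Γ) (labels-tL Δ)

translate-rule : ∀ {ps} → Rule PAL S ps →
  Rule EL (tS S) (map tS ps) ⊎ (∃ λ S′ → ps ≡ S′ ∷ [] × tS S′ ≡ tS S)
translate-rule init-p = inj₁ init-p
translate-rule init-r = inj₁ init-r
translate-rule ¬L     = inj₁ ¬L
translate-rule ¬R     = inj₁ ¬R
translate-rule ∧L     = inj₁ ∧L
translate-rule ∧R     = inj₁ ∧R
translate-rule →L     = inj₁ →L
translate-rule →R     = inj₁ →R
translate-rule KL     = inj₁ KL
translate-rule (KR {a = a} {x = x} {y = y} {φ = φ} {Γ = Γ} {Δ = Δ} y∉) =
  inj₁ (KR (y∉ ∘ subst (y ∈_) (labelsS-tS (Γ , lab x (K a φ) ∷ Δ))))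
translate-rule Ref    = inj₁ Ref
translate-rule Trans  = inj₁ Trans
translate-rule Sym    = inj₁ Sym
translate-rule R1L    = inj₁ →L
translate-rule R1R    = inj₁ →R
translate-rule R2L    = inj₁ →L
translate-rule R2R    = inj₁ →R
translate-rule R3L    = inj₁ ∧L
translate-rule R3R    = inj₁ ∧R
translate-rule R4L    = inj₁ →L
translate-rule R4R    = inj₁ →R
translate-rule R5L    = inj₁ →L
translate-rule R5R    = inj₁ →R
translate-rule R6L    = inj₂ (-, refl , refl)
translate-rule R6R    = inj₂ (-, refl , refl)

mutual
  translate : PAL ⊢[ h ] S → EL ⊢[ h ] tS S
  translate (der r p q ds) with translate-rule r
  ... | inj₁ r′ = der r′ (map⁺ tI p) (map⁺ tI q) (All-map⁺ (translate-all ds))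
  ... | inj₂ (_ , refl , tS≡) with d ∷ [] ← ds =
    ⊢[]-resp-↭ (⊢[]-mono (n≤1+n _) (subst (EL ⊢[ _ ]_) tS≡ (translate d))) (map⁺ tI p) (map⁺ tI q)

  translate-all : ∀ {ps : List (Seq n)} → All (PAL ⊢[ h ]_) ps → All ((EL ⊢[ h ]_) ∘ tS) ps
  translate-all []       = []
  translate-all (d ∷ ds) = translate d ∷ translate-all ds

data Connective {n : ℕ} : Fm n → Set where
  imp : Connective (A →ᶠ B)
  and : Connective (A ∧ᶠ B)

ann-connective : (F β : Fm n) → Connective (ann F β)
ann-connective F (var _)   = imp
ann-connective F (¬ᶠ _)    = imp
ann-connective F (_ ∧ᶠ _)  = and
ann-connective F (_ →ᶠ _)  = imp
ann-connective F (K _ _)   = imp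
ann-connective F ([ ψ ] χ) = ann-connective (F ∧ᶠ ann F ψ) χ

t-inv-var : ∀ (φ : Fm n) {p} → t φ ≡ var p → φ ≡ var p
t-inv-var (var p)   refl = refl
t-inv-var ([ α ] β) eq with () ← subst Connective eq (ann-connective (t α) β)

t-inv-¬ : (φ : Fm n) → t φ ≡ ¬ᶠ A → ∃ λ φ′ → φ ≡ ¬ᶠ φ′ × t φ′ ≡ A
t-inv-¬ (¬ᶠ φ)    refl = φ , refl , refl
t-inv-¬ ([ α ] β) eq with () ← subst Connective eq (ann-connective (t α) β)

t-inv-K : (φ : Fm n) → t φ ≡ K a A → ∃ λ φ′ → φ ≡ K a φ′ × t φ′ ≡ A
t-inv-K (K a φ)   refl = φ , refl , refl
t-inv-K ([ α ] β) eq with () ← subst Connective eq (ann-connective (t α) β)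

-- ImpLike φ A B: the left and right rules for φ in G_PAL, possibly after some R6 steps, have
-- the premises of (→⇒) and (⇒→) for A →ᶠ B; likewise AndLike for (∧⇒) and (⇒∧).
data ImpLike {n : ℕ} : Fm n → Fm n → Fm n → Set where
  imp : ImpLike (A →ᶠ B) A B
  r1  : ∀ {α p} → ImpLike ([ α ] var p) α (var p)
  r2  : ∀ {α ψ} → ImpLike ([ α ] (¬ᶠ ψ)) α (¬ᶠ ([ α ] ψ))
  r4  : ∀ {α ψ₁ ψ₂} → ImpLike ([ α ] (ψ₁ →ᶠ ψ₂)) ([ α ] ψ₁) ([ α ] ψ₂)
  r5  : ∀ {α ψ} → ImpLike ([ α ] K a ψ) α (K a ([ α ] ψ))
  r6  : ∀ {α ψ χ} → ImpLike ([ α ∧ᶠ ([ α ] ψ) ] χ) A B → ImpLike ([ α ] ([ ψ ] χ)) A B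

data AndLike {n : ℕ} : Fm n → Fm n → Fm n → Set where
  and : AndLike (A ∧ᶠ B) A B
  r3  : ∀ {α ψ₁ ψ₂} → AndLike ([ α ] (ψ₁ ∧ᶠ ψ₂)) ([ α ] ψ₁) ([ α ] ψ₂)
  r6  : ∀ {α ψ χ} → AndLike ([ α ∧ᶠ ([ α ] ψ) ] χ) A B → AndLike ([ α ] ([ ψ ] χ)) A B

record Preimage {n : ℕ} (V : Fm n → Fm n → Fm n → Set) (φ A B : Fm n) : Set where
  constructor preimage
  field
    {A′ B′} : Fm n
    shape   : V φ A′ B′
    t-A′    : t A′ ≡ A
    t-B′    : t B′ ≡ B

ann-inv-→ : (α β : Fm n) → ann (t α) β ≡ A →ᶠ B → Preimage ImpLike ([ α ] β) A B
ann-inv-→ α (var p)   refl = preimage r1 refl refl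
ann-inv-→ α (¬ᶠ β)    refl = preimage r2 refl refl
ann-inv-→ α (β →ᶠ γ)  refl = preimage r4 refl refl
ann-inv-→ α (K i β)   refl = preimage r5 refl refl
ann-inv-→ α ([ ψ ] χ) eq with preimage v tA tB ← ann-inv-→ (α ∧ᶠ ([ α ] ψ)) χ eq =
  preimage (r6 v) tA tB

t-inv-→ : (φ : Fm n) → t φ ≡ A →ᶠ B → Preimage ImpLike φ A B
t-inv-→ (φ →ᶠ ψ)  refl = preimage imp refl refl
t-inv-→ ([ α ] β) eq   = ann-inv-→ α β eq

ann-inv-∧ : (α β : Fm n) → ann (t α) β ≡ A ∧ᶠ B → Preimage AndLike ([ α ] β) A B
ann-inv-∧ α (β ∧ᶠ γ)  refl = preimage r3 refl refl
ann-inv-∧ α ([ ψ ] χ) eq with preimage v tA tB ← ann-inv-∧ (α ∧ᶠ ([ α ] ψ)) χ eq =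
  preimage (r6 v) tA tB

t-inv-∧ : (φ : Fm n) → t φ ≡ A ∧ᶠ B → Preimage AndLike φ A B
t-inv-∧ (φ ∧ᶠ ψ)  refl = preimage and refl refl
t-inv-∧ ([ α ] β) eq   = ann-inv-∧ α β eq

ImpLike-L : ∀ {φ} → ImpLike φ A B →
  PAL ⊢ (Γ , lab x A ∷ Δ) → PAL ⊢ (lab x B ∷ Γ , Δ) → PAL ⊢ (lab x φ ∷ Γ , Δ)
ImpLike-L imp    d e = ⊢-rule₂ →L d e
ImpLike-L r1     d e = ⊢-rule₂ R1L d e
ImpLike-L r2     d e = ⊢-rule₂ R2L d e
ImpLike-L r4     d e = ⊢-rule₂ R4L d e
ImpLike-L r5     d e = ⊢-rule₂ R5L d e
ImpLike-L (r6 v) d e = ⊢-rule₁ R6L (ImpLike-L v d e)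

ImpLike-R : ∀ {φ} → ImpLike φ A B → PAL ⊢ (lab x A ∷ Γ , lab x B ∷ Δ) → PAL ⊢ (Γ , lab x φ ∷ Δ)
ImpLike-R imp    d = ⊢-rule₁ →R d
ImpLike-R r1     d = ⊢-rule₁ R1R d
ImpLike-R r2     d = ⊢-rule₁ R2R d
ImpLike-R r4     d = ⊢-rule₁ R4R d
ImpLike-R r5     d = ⊢-rule₁ R5R d
ImpLike-R (r6 v) d = ⊢-rule₁ R6R (ImpLike-R v d)

AndLike-L : ∀ {φ} → AndLike φ A B → PAL ⊢ (lab x A ∷ lab x B ∷ Γ , Δ) → PAL ⊢ (lab x φ ∷ Γ , Δ)
AndLike-L and    d = ⊢-rule₁ ∧L d
AndLike-L r3     d = ⊢-rule₁ R3L d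
AndLike-L (r6 v) d = ⊢-rule₁ R6L (AndLike-L v d)

AndLike-R : ∀ {φ} → AndLike φ A B →
  PAL ⊢ (Γ , lab x A ∷ Δ) → PAL ⊢ (Γ , lab x B ∷ Δ) → PAL ⊢ (Γ , lab x φ ∷ Δ)
AndLike-R and    d e = ⊢-rule₂ ∧R d e
AndLike-R r3     d e = ⊢-rule₂ R3R d e
AndLike-R (r6 v) d e = ⊢-rule₁ R6R (AndLike-R v d e)

tL-lab-∷⁻ : ∀ (Γ : List (Item n)) → lab x F ∷ Γ₀ ≡ tL Γ →
  ∃₂ λ φ Γ₁ → Γ ≡ lab x φ ∷ Γ₁ × t φ ≡ F × Γ₀ ≡ tL Γ₁
tL-lab-∷⁻ (lab x φ ∷ Γ₁) refl = φ , Γ₁ , refl , refl , refl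

tL-rel-∷⁻ : ∀ (Γ : List (Item n)) {y} → rel a x y ∷ Γ₀ ≡ tL Γ →
  ∃ λ Γ₁ → Γ ≡ rel a x y ∷ Γ₁ × Γ₀ ≡ tL Γ₁
tL-rel-∷⁻ (rel a x y ∷ Γ₁) refl = Γ₁ , refl , refl

mutual
  reflect : ∀ h {Γ Δ : List (Item n)} → EL ⊢[ h ] tS (Γ , Δ) → PAL ⊢ (Γ , Δ)
  -- A permutation of a translated list is the translation of a permutation, so the
  -- conclusion of the last rule is itself a translated sequent.
  reflect (suc h) (der r p q ds)
    with Γ* , Γr≡ , σ ← ↭-map-inv tI p | Δ* , Δr≡ , τ ← ↭-map-inv tI q =
    ⊢-resp-↭ (reflect-rule h r Γr≡ Δr≡ ds) σ τ

  reflect-rule : ∀ h {Γ Δ Γr Δr : List (Item n)} {ps} → Rule EL (Γr , Δr) ps →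
    Γr ≡ tL Γ → Δr ≡ tL Δ → All (EL ⊢[ h ]_) ps → PAL ⊢ (Γ , Δ)
  reflect-rule h {Γ} {Δ} init-p Γr≡ Δr≡ []
    with φ , _ , refl , tφ≡ , refl ← tL-lab-∷⁻ Γ Γr≡ | ψ , _ , refl , tψ≡ , refl ← tL-lab-∷⁻ Δ Δr≡
    with refl ← t-inv-var φ tφ≡ | refl ← t-inv-var ψ tψ≡ = 1 , der init-p ↭-refl ↭-refl []
  reflect-rule h {Γ} {Δ} init-r Γr≡ Δr≡ []
    with _ , refl , refl ← tL-rel-∷⁻ Γ Γr≡ | _ , refl , refl ← tL-rel-∷⁻ Δ Δr≡ =
    1 , der init-r ↭-refl ↭-refl []
  reflect-rule h {Γ} ¬L Γr≡ refl (d ∷ [])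
    with φ , _ , refl , tφ≡ , refl ← tL-lab-∷⁻ Γ Γr≡
    with φ′ , refl , refl ← t-inv-¬ φ tφ≡ = ⊢-rule₁ ¬L (reflect h d)
  reflect-rule h {Δ = Δ} ¬R refl Δr≡ (d ∷ [])
    with φ , _ , refl , tφ≡ , refl ← tL-lab-∷⁻ Δ Δr≡
    with φ′ , refl , refl ← t-inv-¬ φ tφ≡ = ⊢-rule₁ ¬R (reflect h d)
  reflect-rule h {Γ} ∧L Γr≡ refl (d ∷ [])
    with φ , _ , refl , tφ≡ , refl ← tL-lab-∷⁻ Γ Γr≡
    with preimage v refl refl ← t-inv-∧ φ tφ≡ = AndLike-L v (reflect h d)
  reflect-rule h {Δ = Δ} ∧R refl Δr≡ (d ∷ e ∷ [])
    with φ , _ , refl , tφ≡ , refl ← tL-lab-∷⁻ Δ Δr≡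
    with preimage v refl refl ← t-inv-∧ φ tφ≡ = AndLike-R v (reflect h d) (reflect h e)
  reflect-rule h {Γ} →L Γr≡ refl (d ∷ e ∷ [])
    with φ , _ , refl , tφ≡ , refl ← tL-lab-∷⁻ Γ Γr≡
    with preimage v refl refl ← t-inv-→ φ tφ≡ = ImpLike-L v (reflect h d) (reflect h e)
  reflect-rule h {Δ = Δ} →R refl Δr≡ (d ∷ [])
    with φ , _ , refl , tφ≡ , refl ← tL-lab-∷⁻ Δ Δr≡
    with preimage v refl refl ← t-inv-→ φ tφ≡ = ImpLike-R v (reflect h d)
  reflect-rule h {Γ} KL Γr≡ refl (d ∷ [])
    with φ , Γ₁ , refl , tφ≡ , Γ₀≡ ← tL-lab-∷⁻ Γ Γr≡
    with _ , refl , refl ← tL-rel-∷⁻ Γ₁ Γ₀≡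
    with φ′ , refl , refl ← t-inv-K φ tφ≡ = ⊢-rule₁ KL (reflect h d)
  reflect-rule h {Γ} {Δ} (KR {a = a} {x = x} {y = y} y∉) refl Δr≡ (d ∷ [])
    with φ , Δ₁ , refl , tφ≡ , refl ← tL-lab-∷⁻ Δ Δr≡
    with φ′ , refl , refl ← t-inv-K φ tφ≡ =
    ⊢-rule₁ (KR (y∉ ∘ subst (y ∈_) (sym (labelsS-tS (Γ , lab x (K a φ′) ∷ Δ₁))))) (reflect h d)
  reflect-rule h Ref refl refl (d ∷ []) = ⊢-rule₁ Ref (reflect h d)
  reflect-rule h {Γ} Trans Γr≡ refl (d ∷ [])
    with Γ₁ , refl , Γ₀≡ ← tL-rel-∷⁻ Γ Γr≡
    with _ , refl , refl ← tL-rel-∷⁻ Γ₁ Γ₀≡ = ⊢-rule₁ Trans (reflect h d)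
  reflect-rule h {Γ} Sym Γr≡ refl (d ∷ [])
    with _ , refl , refl ← tL-rel-∷⁻ Γ Γr≡ = ⊢-rule₁ Sym (reflect h d)

mainTheorem3 : ∀ (n : ℕ) (Γ Δ : List (Item n)) →
    (EL ⊢ tS (Γ , Δ) → PAL ⊢ (Γ , Δ)) ×
    (∀ (h : ℕ) → 1 ≤ h → PAL ⊢[ h ] (Γ , Δ) → EL ⊢[ h ] tS (Γ , Δ))
mainTheorem3 n Γ Δ = (λ (h , d) → reflect h d) , (λ _ _ → translate)
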